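{- Let $C,C'$ be commands, $(s,h),(s',h')\in\mathcal{S}$ and $O,L,D,O',L',D'\subseteq\mathbf{Res}$. If $(O,L,D)$ is a resource configuration and $C,(s,h,(O,L,D))\to_p C',(s',h',(O',L',D'))$, then $(O',L',D')$ is a resource configuration, $L=L'$ and $O\cup D=O'\cup D'$.
   Context: $\mathcal{S}$ is the set of pairs $(s,h)$ of a store $s:\mathbf{Var}\to\mathbf{Val}$ and a finite partial heap $h:\mathbf{Loc}\rightharpoonup\mathbf{Val}$; $\mathbf{Res}$ is a set of resource names. A resource configuration is a triple $(O,L,D)$ of pairwise disjoint subsets of $\mathbf{Res}$ (owned, locked by others, available); $r\in\rho$ iff $r\in O\cup L\cup D$; $\rho\setminus\{r\}=(O\setminus\{r\},L\setminus\{r\},D\setminus\{r\})$. Commands: $\mathsf{skip}$; basic commands $c$ ($x:=e$, $x:=[e]$, $[e]:=e'$, $x:=\mathsf{cons}(e_1,..,e_n)$, $\mathsf{dispose}(e)$) with standard separation-logic semantics $[c](s,h)$ (a pair or $\mathsf{abort}$); $C_1;C_2$; $\mathsf{if}\ B\ \mathsf{then}\ C_1\ \mathsf{else}\ C_2$; $\mathsf{while}\ B\ \mathsf{do}\ C$; $\mathsf{resource}\ r\ \mathsf{in}\ C$; $\mathsf{with}\ r\ \mathsf{when}\ B\ \mathsf{do}\ C$; $C_1\|C_2$; $\mathsf{within}\ r\ \mathsf{do}\ C$. $Locked(C_1;C_2)=Locked(C_1)$, $Locked(C_1\|C_2)=Locked(C_1)\cup Locked(C_2)$, $Locked(\mathsf{resource}\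 r\ \mathsf{in}\ C)=Locked(C)\setminus\{r\}$, $Locked(\mathsf{within}\ r\ \mathsf{do}\ C)=Locked(C)\cup\{r\}$, otherwise $\emptyset$. The program transition relation $\to_p$ on non-abort configurations is the least relation closed under: (S1) $\mathsf{skip};C_2,\sigma\to_pC_2,\sigma$; (S2) if $C_1,\sigma\to_pC_1',\sigma'$ then $C_1;C_2,\sigma\to_pC_1';C_2,\sigma'$; (LP) $\mathsf{while}\ B\ \mathsf{do}\ C,\sigma\to_p\mathsf{if}\ B\ \mathsf{then}\ (C;\mathsf{while}\ B\ \mathsf{do}\ C)\ \mathsf{else}\ \mathsf{skip},\sigma$; (IF1/IF2) conditional to $C_1$ / $C_2$ with same state according to $s(B)$; (P1/P2) if a component of $C_1\|C_2$ steps, so does the parallel composition (same new state); (P3) $\mathsf{skip}\|\mathsf{skip},\sigma\to_p\mathsf{skip},\sigma$; (R0) $\mathsf{resource}\ r\ \mathsf{in}\ \mathsf{skip},(s,h,\rho)\to_p\mathsf{skip},(s,h,\rho)$ if $r\notin\rho$; (R1) if $r\notin\rho=(O,L,D)$, $r\in Locked(C)$ and $C,(s,h,(O\cup\{r\},L,D))\to_pC',(s',h',\rho')$ then $\mathsf{resource}\ r\ \mathsf{in}\ C,(s,h,\rho)\to_p\mathsf{resource}\ r\ \mathsf{in}\ C',(s',h',\rho'\setminus\{r\})$; (R2) same with $r\notin Locked(C)$ and $(O,L,D\cup\{r\})$; (W0) $\mathsf{with}\ r\ \mathsf{when}\ B\ \mathsf{do}\ C,(s,h,(O,L,D\cup\{r\}))\to_p\mathsf{within}\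 r\ \mathsf{do}\ C,(s,h,(O\cup\{r\},L,D))$ if $s(B)=\texttt{true}$; (W1) if $r\in O$ and $C,(s,h,(O\setminus\{r\},L,D))\to_pC',(s',h',(O',L',D'))$ then $\mathsf{within}\ r\ \mathsf{do}\ C,(s,h,(O,L,D))\to_p\mathsf{within}\ r\ \mathsf{do}\ C',(s',h',(O'\cup\{r\},L',D'))$; (W2) $\mathsf{within}\ r\ \mathsf{do}\ \mathsf{skip},(s,h,(O\cup\{r\},L,D))\to_p\mathsf{skip},(s,h,(O,L,D\cup\{r\}))$; (BCT) $c,(s,h,\rho)\to_p\mathsf{skip},(s',h',\rho)$ if $[c](s,h)=(s',h')$. -}

module Defs where

open import Level using (0ℓ)
open import Data.Nat using (ℕ; zero; suc; _+_; _≡ᵇ_)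
open import Data.Integer using (ℤ; +_; _-_; _≤ᵇ_) renaming (_+_ to _+ℤ_; _*_ to _*ℤ_)
import Data.Integer as ℤ
open import Data.Bool using (Bool; true; false; if_then_else_; not; _∧_; _∨_)
open import Data.Maybe using (Maybe; just; nothing)
open import Data.List using (List; []; _∷_; length; filter)
open import Data.Product using (_×_; _,_; Σ; ∃)
open import Data.Sum using (_⊎_)
open import Relation.Nullary using (¬_; does)
open import Relation.Unary using (Pred; _∈_; _∉_; _∪_; _∖_; ｛_｝; _⊥_)
open import Relation.Binary.PropositionalEquality using (_≡_)

Var : Set
Var = ℕ

Val : Set
Val = ℤ

-- Locations are the non-negative integers (Loc ⊆ Val via +_)
Loc : Set
Loc = ℕ

Res : Set
Res = ℕ

RSet : Set₁
RSet = Pred Res 0ℓ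

Store : Set
Store = Var → Val

-- A finite partial heap, as an association list (the first binding of a
-- location is the one that counts).
Heap : Set
Heap = List (Loc × Val)

lookupH : Heap → Loc → Maybe Val
lookupH []            l = nothing
lookupH ((k , v) ∷ h) l = if k ≡ᵇ l then just v else lookupH h l

_∈dom_ : Loc → Heap → Set
l ∈dom h = ∃ λ v → lookupH h l ≡ just v

_∉dom_ : Loc → Heap → Set
l ∉dom h = lookupH h l ≡ nothing

updH : Heap → Loc → Val → Heap
updH h l v = (l , v) ∷ h

remH : Heap → Loc → Heap
remH []            l = []
remH ((k , v) ∷ h) l = if k ≡ᵇ l then remH h l else (k , v) ∷ remH h l

updS : Store → Var → Val → Store
updS s x v y = if y ≡ᵇ x then v else s y

data Exp : Set where
  var  : Var → Exp
  lit  : ℤ → Exp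
  _⊕_  : Exp → Exp → Exp
  _⊖_  : Exp → Exp → Exp
  _⊗_  : Exp → Exp → Exp

data BExp : Set where
  btrue bfalse : BExp
  _≐e_ : Exp → Exp → BExp
  _≤e_ : Exp → Exp → BExp
  bnot : BExp → BExp
  _∧e_ : BExp → BExp → BExp
  _∨e_ : BExp → BExp → BExp

⟦_⟧ : Exp → Store → Val
⟦ var x ⟧ s = s x
⟦ lit n ⟧ s = n
⟦ e ⊕ e' ⟧ s = ⟦ e ⟧ s +ℤ ⟦ e' ⟧ s
⟦ e ⊖ e' ⟧ s = ⟦ e ⟧ s - ⟦ e' ⟧ s
⟦ e ⊗ e' ⟧ s = ⟦ e ⟧ s *ℤ ⟦ e' ⟧ s

⟦_⟧b : BExp → Store → Bool
⟦ btrue ⟧b s = true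
⟦ bfalse ⟧b s = false
⟦ e ≐e e' ⟧b s = does (⟦ e ⟧ s ℤ.≟ ⟦ e' ⟧ s)
⟦ e ≤e e' ⟧b s = ⟦ e ⟧ s ≤ᵇ ⟦ e' ⟧ s
⟦ bnot b ⟧b s = not (⟦ b ⟧b s)
⟦ b ∧e b' ⟧b s = ⟦ b ⟧b s ∧ ⟦ b' ⟧b s
⟦ b ∨e b' ⟧b s = ⟦ b ⟧b s ∨ ⟦ b' ⟧b s

data BCmd : Set where
  assign  : Var → Exp → BCmd
  load    : Var → Exp → BCmd
  store   : Exp → Exp → BCmd
  cons    : Var → List Exp → BCmd
  dispose : Exp → BCmd

freshBlock : Heap → Loc → ℕ → Set
freshBlock h l zero    = ⊤′
  where open import Data.Unit using () renaming (⊤ to ⊤′)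
freshBlock h l (suc n) = (l ∉dom h) × freshBlock h (suc l) n

allocH : Heap → Loc → List Val → Heap
allocH h l []       = h
allocH h l (v ∷ vs) = updH (allocH h (suc l) vs) l v

evalList : List Exp → Store → List Val
evalList []       s = []
evalList (e ∷ es) s = ⟦ e ⟧ s ∷ evalList es s

-- [c](s,h) = (s',h')   (non-aborting outcomes; x := cons(..) is
-- nondeterministic in the choice of the fresh block)
data BSem : BCmd → Store → Heap → Store → Heap → Set where
  sem-assign  : ∀ {x e s h} →
    BSem (assign x e) s h (updS s x (⟦ e ⟧ s)) h
  sem-load    : ∀ {x e s h l v} → ⟦ e ⟧ s ≡ + l → lookupH h l ≡ just v →
    BSem (load x e) s h (updS s x v) h
  sem-store   : ∀ {e e' s h l} → ⟦ e ⟧ s ≡ + l → l ∈dom h →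
    BSem (store e e') s h s (updH h l (⟦ e' ⟧ s))
  sem-cons    : ∀ {x es s h l} → freshBlock h l (length es) →
    BSem (cons x es) s h (updS s x (+ l)) (allocH h l (evalList es s))
  sem-dispose : ∀ {e s h l} → ⟦ e ⟧ s ≡ + l → l ∈dom h →
    BSem (dispose e) s h s (remH h l)

data Cmd : Set where
  skip         : Cmd
  basic        : BCmd → Cmd
  _︔_          : Cmd → Cmd → Cmd
  ifC          : BExp → Cmd → Cmd → Cmd
  whileC       : BExp → Cmd → Cmd
  resourceC    : Res → Cmd → Cmd
  withC        : Res → BExp → Cmd → Cmd
  _∥_          : Cmd → Cmd → Cmd
  withinC      : Res → Cmd → Cmd

Locked : Cmd → RSet
Locked (C₁ ︔ C₂)         = Locked C₁
Locked (C₁ ∥ C₂)         = Locked C₁ ∪ Locked C₂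
Locked (resourceC r C) = Locked C ∖ ｛ r ｝
Locked (withinC r C)   = Locked C ∪ ｛ r ｝
Locked _                 = λ _ → ⊥′
  where open import Data.Empty using () renaming (⊥ to ⊥′)

record RConf : Set₁ where
  constructor ⟨_,_,_⟩
  field
    O L D : RSet
open RConf public

_∈ρ_ : Res → RConf → Set
r ∈ρ ⟨ O , L , D ⟩ = r ∈ O ⊎ r ∈ L ⊎ r ∈ D

_∖ρ_ : RConf → Res → RConf
⟨ O , L , D ⟩ ∖ρ r = ⟨ O ∖ ｛ r ｝ , L ∖ ｛ r ｝ , D ∖ ｛ r ｝ ⟩

IsResConf : RConf → Set
IsResConf ⟨ O , L , D ⟩ = (O ⊥ L) × (O ⊥ D) × (L ⊥ D)

-- Rule patterns like (O, L, D ∪ {r}) with the resulting (O ∪ {r}, L, D)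
-- are read as disjoint unions: the configuration is (O,L,D) with r ∈ D and
-- the result is (O ∪ {r}, L, D ∖ {r})  (similarly for W2, W1).

infix 3 _,_,_,_⟶p_,_,_,_

data _,_,_,_⟶p_,_,_,_ : Cmd → Store → Heap → RConf →
                        Cmd → Store → Heap → RConf → Set₁ where
  S1  : ∀ {C₂ s h ρ} → (skip ︔ C₂) , s , h , ρ ⟶p C₂ , s , h , ρ
  S2  : ∀ {C₁ C₁' C₂ s h ρ s' h' ρ'} →
        C₁ , s , h , ρ ⟶p C₁' , s' , h' , ρ' →
        (C₁ ︔ C₂) , s , h , ρ ⟶p (C₁' ︔ C₂) , s' , h' , ρ'
  LP  : ∀ {B C s h ρ} →
        (whileC B C) , s , h , ρ ⟶p
          (ifC B (C ︔ (whileC B C)) skip) , s , h , ρ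
  IF1 : ∀ {B C₁ C₂ s h ρ} → ⟦ B ⟧b s ≡ true →
        (ifC B C₁ C₂) , s , h , ρ ⟶p C₁ , s , h , ρ
  IF2 : ∀ {B C₁ C₂ s h ρ} → ⟦ B ⟧b s ≡ false →
        (ifC B C₁ C₂) , s , h , ρ ⟶p C₂ , s , h , ρ
  P1  : ∀ {C₁ C₁' C₂ s h ρ s' h' ρ'} →
        C₁ , s , h , ρ ⟶p C₁' , s' , h' , ρ' →
        (C₁ ∥ C₂) , s , h , ρ ⟶p (C₁' ∥ C₂) , s' , h' , ρ'
  P2  : ∀ {C₁ C₂ C₂' s h ρ s' h' ρ'} →
        C₂ , s , h , ρ ⟶p C₂' , s' , h' , ρ' →
        (C₁ ∥ C₂) , s , h , ρ ⟶p (C₁ ∥ C₂') , s' , h' , ρ'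
  P3  : ∀ {s h ρ} → (skip ∥ skip) , s , h , ρ ⟶p skip , s , h , ρ
  R0  : ∀ {r s h ρ} → ¬ (r ∈ρ ρ) →
        (resourceC r skip) , s , h , ρ ⟶p skip , s , h , ρ
  R1  : ∀ {r C C' s h O L D s' h' ρ'} →
        ¬ (r ∈ρ ⟨ O , L , D ⟩) → r ∈ Locked C →
        C , s , h , ⟨ O ∪ ｛ r ｝ , L , D ⟩ ⟶p C' , s' , h' , ρ' →
        (resourceC r C) , s , h , ⟨ O , L , D ⟩ ⟶p
          (resourceC r C') , s' , h' , (ρ' ∖ρ r)
  R2  : ∀ {r C C' s h O L D s' h' ρ'} →
        ¬ (r ∈ρ ⟨ O , L , D ⟩) → r ∉ Locked C →
        C , s , h , ⟨ O , L , D ∪ ｛ r ｝ ⟩ ⟶p C' , s' , h' , ρ' →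
        (resourceC r C) , s , h , ⟨ O , L , D ⟩ ⟶p
          (resourceC r C') , s' , h' , (ρ' ∖ρ r)
  W0  : ∀ {r B C s h O L D} → r ∈ D → ⟦ B ⟧b s ≡ true →
        (withC r B C) , s , h , ⟨ O , L , D ⟩ ⟶p
          (withinC r C) , s , h , ⟨ O ∪ ｛ r ｝ , L , D ∖ ｛ r ｝ ⟩
  W1  : ∀ {r C C' s h O L D s' h' O' L' D'} → r ∈ O →
        C , s , h , ⟨ O ∖ ｛ r ｝ , L , D ⟩ ⟶p C' , s' , h' , ⟨ O' , L' , D' ⟩ →
        (withinC r C) , s , h , ⟨ O , L , D ⟩ ⟶p
          (withinC r C') , s' , h' , ⟨ O' ∪ ｛ r ｝ , L' , D' ⟩
  W2  : ∀ {r s h O L D} → r ∈ O →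
        (withinC r skip) , s , h , ⟨ O , L , D ⟩ ⟶p
          skip , s , h , ⟨ O ∖ ｛ r ｝ , L , D ∪ ｛ r ｝ ⟩
  BCT : ∀ {c s h ρ s' h'} → BSem c s h s' h' →
        basic c , s , h , ρ ⟶p skip , s' , h' , ρ

-- A step never touches the resources locked by other threads, and only moves the
-- thread's own resources between "owned" and "available"; disjointness survives
-- because the only resource added to a component (by W0, W1, W2 or inside
-- resource r in C) is one known to lie outside the other components. Rules R1
-- and R2 introduce r as fresh and hide it again afterwards.
module Submission where

open import Level using (Level)
open import Data.Empty using (⊥-elim)
open import Data.Product using (_×_; _,_; proj₁; proj₂)
open import Data.Sum using (inj₁; inj₂)
import Data.Sum as Sum
open import Data.Nat using (_≟_)
open import Function using (id; _∘_)
open import Relation.Binary.Definitions using (DecidableEquality)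
open import Relation.Binary.PropositionalEquality using (refl)
open import Relation.Nullary using (¬_; yes; no)
open import Relation.Unary using (Pred; _∈_; _∉_; _⊆_; _≐_; _∪_; _∖_; ｛_｝)
open import Relation.Unary.Properties using (≐-refl; ≐-sym; ≐-trans)

open import Defs

module _ {a} {A : Set a} where

  private
    variable
      ℓ₁ ℓ₂ ℓ₃ ℓ₄ : Level
      P : Pred A ℓ₁
      Q : Pred A ℓ₂
      P′ : Pred A ℓ₃
      Q′ : Pred A ℓ₄
      R : Pred A ℓ₃
      x : A

  ∪-cong : P ≐ P′ → Q ≐ Q′ → P ∪ Q ≐ P′ ∪ Q′
  ∪-cong (P⊆P′ , P′⊆P) (Q⊆Q′ , Q′⊆Q) = Sum.map P⊆P′ Q⊆Q′ , Sum.map P′⊆P Q′⊆Q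

  ∖-congˡ : P ≐ Q → P ∖ R ≐ Q ∖ R
  ∖-congˡ (P⊆Q , Q⊆P) = (λ (p , ∉R) → P⊆Q p , ∉R) , (λ (q , ∉R) → Q⊆P q , ∉R)

  ∪-assoc : (P ∪ Q) ∪ R ≐ P ∪ (Q ∪ R)
  ∪-assoc = Sum.assocʳ , Sum.assocˡ

  ∪-swapʳ-⊆ : (P ∪ Q) ∪ R ⊆ (P ∪ R) ∪ Q
  ∪-swapʳ-⊆ (inj₁ (inj₁ p)) = inj₁ (inj₁ p)
  ∪-swapʳ-⊆ (inj₁ (inj₂ q)) = inj₂ q
  ∪-swapʳ-⊆ (inj₂ r)        = inj₁ (inj₂ r)

  ∪-swapʳ : (P ∪ Q) ∪ R ≐ (P ∪ R) ∪ Q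
  ∪-swapʳ {P = P} {Q = Q} {R = R} =
    ∪-swapʳ-⊆ {P = P} {Q = Q} {R = R} , ∪-swapʳ-⊆ {P = P} {Q = R} {R = Q}

  ∖-distribʳ-∪ : (P ∪ Q) ∖ R ≐ (P ∖ R) ∪ (Q ∖ R)
  ∖-distribʳ-∪ = (λ { (inj₁ p , ∉R) → inj₁ (p , ∉R) ; (inj₂ q , ∉R) → inj₂ (q , ∉R) })
               , (λ { (inj₁ (p , ∉R)) → inj₁ p , ∉R ; (inj₂ (q , ∉R)) → inj₂ q , ∉R })

  ∖-｛｝-fresh : x ∉ P → P ∖ ｛ x ｝ ≐ P
  ∖-｛｝-fresh x∉P = proj₁ , λ p → p , λ { refl → x∉P p }

  ∪-｛｝-∖-｛｝ : x ∉ P → (P ∪ ｛ x ｝) ∖ ｛ x ｝ ≐ P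
  ∪-｛｝-∖-｛｝ x∉P =
      (λ { (inj₁ p , _) → p ; (inj₂ x≡y , x≢y) → ⊥-elim (x≢y x≡y) })
    , (λ p → inj₁ p , λ { refl → x∉P p })

  ∖-｛｝-∪-｛｝ : DecidableEquality A → x ∈ P → P ≐ (P ∖ ｛ x ｝) ∪ ｛ x ｝
  ∖-｛｝-∪-｛｝ {x = x} {P = P} _≟ᴬ_ x∈P = to , from
    where
    to : P ⊆ (P ∖ ｛ x ｝) ∪ ｛ x ｝
    to {y} p with x ≟ᴬ y
    ... | yes x≡y = inj₂ x≡y
    ... | no  x≢y = inj₁ (p , x≢y)
    from : (P ∖ ｛ x ｝) ∪ ｛ x ｝ ⊆ P
    from (inj₁ (p , _)) = p
    from (inj₂ refl)    = x∈P

private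
  variable
    r : Res
    ρ ρ′ ρ″ : RConf
    O₁ L₁ D₁ O₂ L₂ D₂ : RSet

infix 4 _≈ρ_
_≈ρ_ : RConf → RConf → Set
ρ ≈ρ ρ′ = (L ρ ≐ L ρ′) × (O ρ ∪ D ρ ≐ O ρ′ ∪ D ρ′)

≈ρ-refl : ρ ≈ρ ρ
≈ρ-refl = ≐-refl , ≐-refl

≈ρ-sym : ρ ≈ρ ρ′ → ρ′ ≈ρ ρ
≈ρ-sym (L≐ , U≐) = ≐-sym L≐ , ≐-sym U≐

≈ρ-trans : ρ ≈ρ ρ′ → ρ′ ≈ρ ρ″ → ρ ≈ρ ρ″
≈ρ-trans (L≐ , U≐) (L≐′ , U≐′) = ≐-trans L≐ L≐′ , ≐-trans U≐ U≐′

≈ρ-pointwise : O₁ ≐ O₂ → L₁ ≐ L₂ → D₁ ≐ D₂ → ⟨ O₁ , L₁ , D₁ ⟩ ≈ρ ⟨ O₂ , L₂ , D₂ ⟩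
≈ρ-pointwise O≐ L≐ D≐ = L≐ , ∪-cong O≐ D≐

≈ρ-∉ρ : ρ ≈ρ ρ′ → ¬ r ∈ρ ρ → ¬ r ∈ρ ρ′
≈ρ-∉ρ (L≐ , U≐) r∉ρ (inj₁ r∈O′)        = r∉ρ (Sum.map id inj₂ (proj₂ U≐ (inj₁ r∈O′)))
≈ρ-∉ρ (L≐ , U≐) r∉ρ (inj₂ (inj₁ r∈L′)) = r∉ρ (inj₂ (inj₁ (proj₂ L≐ r∈L′)))
≈ρ-∉ρ (L≐ , U≐) r∉ρ (inj₂ (inj₂ r∈D′)) = r∉ρ (Sum.map id inj₂ (proj₂ U≐ (inj₂ r∈D′)))

IsResConf-mono : O₂ ⊆ O₁ → L₂ ⊆ L₁ → D₂ ⊆ D₁ →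
                 IsResConf ⟨ O₁ , L₁ , D₁ ⟩ → IsResConf ⟨ O₂ , L₂ , D₂ ⟩
IsResConf-mono O⊆ L⊆ D⊆ (O⊥L , O⊥D , L⊥D) =
    (λ (o , l) → O⊥L (O⊆ o , L⊆ l))
  , (λ (o , d) → O⊥D (O⊆ o , D⊆ d))
  , (λ (l , d) → L⊥D (L⊆ l , D⊆ d))

∖ρ-IsResConf : IsResConf ρ → IsResConf (ρ ∖ρ r)
∖ρ-IsResConf = IsResConf-mono proj₁ proj₁ proj₁

∖ρ-cong : ρ ≈ρ ρ′ → ρ ∖ρ r ≈ρ ρ′ ∖ρ r
∖ρ-cong {r = r} (L≐ , U≐) =
    ∖-congˡ L≐
  , ≐-trans (≐-sym ∖-distribʳ-∪) (≐-trans (∖-congˡ U≐) (∖-distribʳ-∪ {R = ｛ r ｝}))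

addOwned addAvailable removeOwned removeAvailable : Res → RConf → RConf
addOwned        r ⟨ O , L , D ⟩ = ⟨ O ∪ ｛ r ｝ , L , D ⟩
addAvailable    r ⟨ O , L , D ⟩ = ⟨ O , L , D ∪ ｛ r ｝ ⟩
removeOwned     r ⟨ O , L , D ⟩ = ⟨ O ∖ ｛ r ｝ , L , D ⟩
removeAvailable r ⟨ O , L , D ⟩ = ⟨ O , L , D ∖ ｛ r ｝ ⟩

addOwned-IsResConf : ¬ r ∈ρ ρ → IsResConf ρ → IsResConf (addOwned r ρ)
addOwned-IsResConf r∉ρ (O⊥L , O⊥D , L⊥D) =
    (λ { (inj₁ o , l) → O⊥L (o , l) ; (inj₂ refl , l) → r∉ρ (inj₂ (inj₁ l)) })
  , (λ { (inj₁ o , d) → O⊥D (o , d) ; (inj₂ refl , d) → r∉ρ (inj₂ (inj₂ d)) })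
  , L⊥D

addAvailable-IsResConf : ¬ r ∈ρ ρ → IsResConf ρ → IsResConf (addAvailable r ρ)
addAvailable-IsResConf r∉ρ (O⊥L , O⊥D , L⊥D) =
    O⊥L
  , (λ { (o , inj₁ d) → O⊥D (o , d) ; (o , inj₂ refl) → r∉ρ (inj₁ o) })
  , (λ { (l , inj₁ d) → L⊥D (l , d) ; (l , inj₂ refl) → r∉ρ (inj₂ (inj₁ l)) })

removeOwned-IsResConf : IsResConf ρ → IsResConf (removeOwned r ρ)
removeOwned-IsResConf = IsResConf-mono proj₁ id id

removeAvailable-IsResConf : IsResConf ρ → IsResConf (removeAvailable r ρ)
removeAvailable-IsResConf = IsResConf-mono id id proj₁

removeOwned-∉ρ : IsResConf ρ → r ∈ O ρ → ¬ r ∈ρ removeOwned r ρ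
removeOwned-∉ρ _                 _   (inj₁ (_ , r≢r)) = r≢r refl
removeOwned-∉ρ (O⊥L , _ , _)     r∈O (inj₂ (inj₁ r∈L)) = O⊥L (r∈O , r∈L)
removeOwned-∉ρ (_ , O⊥D , _)     r∈O (inj₂ (inj₂ r∈D)) = O⊥D (r∈O , r∈D)

removeAvailable-∉ρ : IsResConf ρ → r ∈ D ρ → ¬ r ∈ρ removeAvailable r ρ
removeAvailable-∉ρ (_ , O⊥D , _) r∈D (inj₁ r∈O)             = O⊥D (r∈O , r∈D)
removeAvailable-∉ρ (_ , _ , L⊥D) r∈D (inj₂ (inj₁ r∈L))      = L⊥D (r∈L , r∈D)
removeAvailable-∉ρ _             _   (inj₂ (inj₂ (_ , r≢r))) = r≢r refl

addOwned-removeOwned : r ∈ O ρ → ρ ≈ρ addOwned r (removeOwned r ρ)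
addOwned-removeOwned r∈O = ≈ρ-pointwise (∖-｛｝-∪-｛｝ _≟_ r∈O) ≐-refl ≐-refl

addAvailable-removeAvailable : r ∈ D ρ → ρ ≈ρ addAvailable r (removeAvailable r ρ)
addAvailable-removeAvailable r∈D = ≈ρ-pointwise ≐-refl ≐-refl (∖-｛｝-∪-｛｝ _≟_ r∈D)

addOwned≈ρaddAvailable : addOwned r ρ ≈ρ addAvailable r ρ
addOwned≈ρaddAvailable = ≐-refl , ≐-trans ∪-swapʳ ∪-assoc

addOwned-cong : ρ ≈ρ ρ′ → addOwned r ρ ≈ρ addOwned r ρ′
addOwned-cong (L≐ , U≐) = L≐ , ≐-trans ∪-swapʳ (≐-trans (∪-cong U≐ ≐-refl) ∪-swapʳ)

addOwned-∖ρ : ¬ r ∈ρ ρ → addOwned r ρ ∖ρ r ≈ρ ρ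
addOwned-∖ρ r∉ρ = ≈ρ-pointwise (∪-｛｝-∖-｛｝ (r∉ρ ∘ inj₁))
                               (∖-｛｝-fresh (r∉ρ ∘ inj₂ ∘ inj₁))
                               (∖-｛｝-fresh (r∉ρ ∘ inj₂ ∘ inj₂))

Preserved : RConf → RConf → Set
Preserved ρ ρ′ = IsResConf ρ′ × ρ ≈ρ ρ′

resource-scope : ¬ r ∈ρ ρ → Preserved (addOwned r ρ) ρ′ → Preserved ρ (ρ′ ∖ρ r)
resource-scope r∉ρ (rc′ , ρ⁺≈ρ′) =
  ∖ρ-IsResConf rc′ , ≈ρ-trans (≈ρ-sym (addOwned-∖ρ r∉ρ)) (∖ρ-cong ρ⁺≈ρ′)

step-preserves : ∀ {C C′ s s′ h h′} → IsResConf ρ →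
                 C , s , h , ρ ⟶p C′ , s′ , h′ , ρ′ → Preserved ρ ρ′
step-preserves rc S1         = rc , ≈ρ-refl
step-preserves rc (S2 step)  = step-preserves rc step
step-preserves rc LP         = rc , ≈ρ-refl
step-preserves rc (IF1 _)    = rc , ≈ρ-refl
step-preserves rc (IF2 _)    = rc , ≈ρ-refl
step-preserves rc (P1 step)  = step-preserves rc step
step-preserves rc (P2 step)  = step-preserves rc step
step-preserves rc P3         = rc , ≈ρ-refl
step-preserves rc (R0 _)     = rc , ≈ρ-refl
step-preserves rc (R1 r∉ρ _ step) =
  resource-scope r∉ρ (step-preserves (addOwned-IsResConf r∉ρ rc) step)
step-preserves rc (R2 r∉ρ _ step)
  with rc′ , ρ⁺≈ρ′ ← step-preserves (addAvailable-IsResConf r∉ρ rc) step =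
  resource-scope r∉ρ (rc′ , ≈ρ-trans addOwned≈ρaddAvailable ρ⁺≈ρ′)
step-preserves rc (W0 r∈D _) =
    addOwned-IsResConf (removeAvailable-∉ρ rc r∈D) (removeAvailable-IsResConf rc)
  , ≈ρ-trans (addAvailable-removeAvailable r∈D) (≈ρ-sym addOwned≈ρaddAvailable)
step-preserves rc (W1 r∈O step)
  with rc′ , ρ⁻≈ρ′ ← step-preserves (removeOwned-IsResConf rc) step =
    addOwned-IsResConf (≈ρ-∉ρ ρ⁻≈ρ′ (removeOwned-∉ρ rc r∈O)) rc′
  , ≈ρ-trans (addOwned-removeOwned r∈O) (addOwned-cong ρ⁻≈ρ′)
step-preserves rc (W2 r∈O)   =
    addAvailable-IsResConf (removeOwned-∉ρ rc r∈O) (removeOwned-IsResConf rc)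
  , ≈ρ-trans (addOwned-removeOwned r∈O) addOwned≈ρaddAvailable
step-preserves rc (BCT _)    = rc , ≈ρ-refl

proposition2 : ∀ (C C' : Cmd) (s s' : Store) (h h' : Heap)
                 (O L D O' L' D' : RSet) →
                 IsResConf ⟨ O , L , D ⟩ →
                 C , s , h , ⟨ O , L , D ⟩ ⟶p C' , s' , h' , ⟨ O' , L' , D' ⟩ →
                 IsResConf ⟨ O' , L' , D' ⟩ × (L ≐ L') × (O ∪ D ≐ O' ∪ D')
proposition2 _ _ _ _ _ _ _ _ _ _ _ _ = step-preserves
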